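{- Let $\Gamma$ be a finite multiset of program clauses and let $G$ be a goal (in the simplified syntax below). Then $\Gamma\longrightarrow G$ has a C-proof if and only if it has a proof in the reduced proof system relative to $G$.
   Context: Formulas are first-order with logical symbols $\top,\bot,\land,\lor,\supset,\exists,\forall$; $\top,\bot$ are not atomic. $[t/x]B$ is capture-avoiding substitution. A sequent $\Gamma\longrightarrow\Delta$ is a pair of finite multisets of formulas. C-proofs: derivations in the classical multiple-succedent sequent calculus whose axioms are sequents with $\top\in\Delta$ or with some $A$ ($\bot$ or atomic) in both $\Gamma$ and $\Delta$, and whose rules are: contr-L ($B,B,\Gamma\longrightarrow\Delta\Rightarrow B,\Gamma\longrightarrow\Delta$), contr-R ($\Gamma\longrightarrow\Delta,B,B\Rightarrow\Gamma\longrightarrow\Delta,B$), $\bot$-R ($\Gamma\longrightarrow\Delta,\bot\Rightarrow\Gamma\longrightarrow\Delta,D$), $\land$-L ($B,D,B\land D,\Gamma\longrightarrow\Delta\Rightarrow B\land D,\Gamma\longrightarrow\Delta$), $\land$-R ($\Gamma\longrightarrow\Delta,B$ and $\Gamma\longrightarrow\Delta,D\Rightarrow\Gamma\longrightarrow\Delta,B\land D$), $\lor$-L ($B,\Gamma\longrightarrow\Delta$ and $D,\Gamma\longrightarrow\Delta\Rightarrow B\lor D,\Gamma\longrightarrow\Delta$), $\lor$-R ($\Gamma\longrightarrow\Delta,B$ or $\Gamma\longrightarrow\Delta,D\Rightarrow\Gamma\longrightarrow\Delta,B\lor D$), $\supset$-L ($B\supset D,\Gamma\longrightarrow B,\Delta$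 and $D,\Gamma\longrightarrow\Theta\Rightarrow B\supset D,\Gamma\longrightarrow\Delta,\Theta$), $\supset$-R ($B,\Gamma\longrightarrow\Delta,D\Rightarrow\Gamma\longrightarrow\Delta,B\supset D$), $\forall$-L ($[t/x]B,\forall xB,\Gamma\longrightarrow\Delta\Rightarrow\forall xB,\Gamma\longrightarrow\Delta$), $\exists$-R ($\Gamma\longrightarrow\Delta,[t/x]B\Rightarrow\Gamma\longrightarrow\Delta,\exists xB$), $\exists$-L ($[c/x]B,\Gamma\longrightarrow\Delta\Rightarrow\exists xB,\Gamma\longrightarrow\Delta$) and $\forall$-R ($\Gamma\longrightarrow\Delta,[c/x]B\Rightarrow\Gamma\longrightarrow\Delta,\forall xB$), with $c$ a constant not in the lower sequent. Simplified syntax: goals $G ::= A \mid G\land G\mid G\lor G\mid D\supset G\mid \exists x\,G$ and program clauses $D ::= (A\lor\dots\lor A)\mid G\supset(A\lor\dots\lor A)\mid \forall x\,D$, where $A$ ranges over atomic formulas, $\top$ and $\bot$. Clause instances: $[A_1\lor\dots\lor A_n]=\{\langle\emptyset,\{A_1,\dots,A_n\}\rangle\}$; $[G'\supset(A_1\lor\dots\lor A_n)]=\{\langle\{G'\},\{A_1,\dots,A_n\}\rangle\}$; $[\forall x D_1]=\bigcup\{[[t/x]D_1] : t \text{ a term}\}$; and $[\Gamma]=\bigcup\{[D]:D\in\Gamma\}$. For a fixed goal $G$, with $\Gamma$ a multiset of program clauses and $C$ an atomic formula or $\bot$ (and $n\ge 0$): RESTART: $\Gamma\longrightarrow G\Rightarrow\Gamma\longrightarrow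 C$. ATOMIC: $A_1,\Gamma\longrightarrow G,\dots,A_n,\Gamma\longrightarrow G\Rightarrow\Gamma\longrightarrow C$, provided $\langle\emptyset,\{C,A_1,\dots,A_n\}\rangle\in[\Gamma]$ or $\langle\emptyset,\{\bot,A_1,\dots,A_n\}\rangle\in[\Gamma]$ (for $n=0$ this is an axiom). BACKCHAIN: $\Gamma\longrightarrow G'$, $A_1,\Gamma\longrightarrow G,\dots,A_n,\Gamma\longrightarrow G\Rightarrow\Gamma\longrightarrow C$, provided $\langle\{G'\},\{C,A_1,\dots,A_n\}\rangle\in[\Gamma]$ or $\langle\{G'\},\{\bot,A_1,\dots,A_n\}\rangle\in[\Gamma]$. The reduced proof system relative to $G$ has as axioms the sequents $\Delta\longrightarrow\top$ and as rules RESTART, ATOMIC and BACKCHAIN relative to $G$ together with the single-succedent rules $\lor$-R ($\Delta\longrightarrow B$ or $\Delta\longrightarrow D\Rightarrow\Delta\longrightarrow B\lor D$), $\land$-R ($\Delta\longrightarrow B$ and $\Delta\longrightarrow D\Rightarrow\Delta\longrightarrow B\land D$), $\supset$-R ($B,\Delta\longrightarrow D\Rightarrow\Delta\longrightarrow B\supset D$) and $\exists$-R ($\Delta\longrightarrow[t/x]B\Rightarrow\Delta\longrightarrow\exists xB$). -}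

module Defs where

open import Data.Nat using (ℕ; zero; suc; _≡ᵇ_)
open import Data.Fin using (Fin; zero; suc)
open import Data.List using (List; []; _∷_; _++_)
open import Data.Bool using (Bool; true; false) renaming (_∨_ to _||_)
open import Data.Maybe using (Maybe; just; nothing)
open import Data.Product using (Σ; _×_; _,_)
open import Data.Sum using (_⊎_)
open import Data.List.Membership.Propositional using (_∈_)
open import Data.List.Relation.Unary.All using (All)
open import Data.List.Relation.Binary.Permutation.Propositional using (_↭_)
open import Relation.Binary.PropositionalEquality using (_≡_)

-- Term n / Formula n : at most n bound variables in scope.

data Term (n : ℕ) : Set where
  var : Fin n → Term n
  fn  : ℕ → List (Term n) → Term n

const : ∀ {n} → ℕ → Term n
const c = fn c []

infixr 6 _∧ᶠ_
infixr 5 _∨ᶠ_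
infixr 4 _⊃ᶠ_

data Formula (n : ℕ) : Set where
  atom        : ℕ → List (Term n) → Formula n
  ⊤ᶠ ⊥ᶠ       : Formula n
  _∧ᶠ_ _∨ᶠ_ _⊃ᶠ_ : Formula n → Formula n → Formula n
  ∀ᶠ ∃ᶠ       : Formula (suc n) → Formula n

mutual
  renT : ∀ {m n} → (Fin m → Fin n) → Term m → Term n
  renT ρ (var i)   = var (ρ i)
  renT ρ (fn f ts) = fn f (renTs ρ ts)

  renTs : ∀ {m n} → (Fin m → Fin n) → List (Term m) → List (Term n)
  renTs ρ []       = []
  renTs ρ (t ∷ ts) = renT ρ t ∷ renTs ρ ts

mutual
  subT : ∀ {m n} → (Fin m → Term n) → Term m → Term n
  subT σ (var i)   = σ i
  subT σ (fn f ts) = fn f (subTs σ ts)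

  subTs : ∀ {m n} → (Fin m → Term n) → List (Term m) → List (Term n)
  subTs σ []       = []
  subTs σ (t ∷ ts) = subT σ t ∷ subTs σ ts

lift : ∀ {m n} → (Fin m → Term n) → Fin (suc m) → Term (suc n)
lift σ zero    = var zero
lift σ (suc i) = renT suc (σ i)

subF : ∀ {m n} → (Fin m → Term n) → Formula m → Formula n
subF σ (atom p ts) = atom p (subTs σ ts)
subF σ ⊤ᶠ          = ⊤ᶠ
subF σ ⊥ᶠ          = ⊥ᶠ
subF σ (B ∧ᶠ D)    = subF σ B ∧ᶠ subF σ D
subF σ (B ∨ᶠ D)    = subF σ B ∨ᶠ subF σ D
subF σ (B ⊃ᶠ D)    = subF σ B ⊃ᶠ subF σ D
subF σ (∀ᶠ B)      = ∀ᶠ (subF (lift σ) B)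
subF σ (∃ᶠ B)      = ∃ᶠ (subF (lift σ) B)

single : ∀ {n} → Term n → Fin (suc n) → Term n
single t zero    = t
single t (suc i) = var i

_[_] : ∀ {n} → Formula (suc n) → Term n → Formula n
B [ t ] = subF (single t) B

-- occurrence of the constant c (i.e. of the term  fn c [])
mutual
  occT : ∀ {n} → ℕ → Term n → Bool
  occT c (var i)        = false
  occT c (fn f [])      = c ≡ᵇ f
  occT c (fn f (t ∷ ts)) = occTs c (t ∷ ts)

  occTs : ∀ {n} → ℕ → List (Term n) → Bool
  occTs c []       = false
  occTs c (t ∷ ts) = occT c t || occTs c ts

occF : ∀ {n} → ℕ → Formula n → Bool
occF c (atom p ts) = occTs c ts
occF c ⊤ᶠ          = false
occF c ⊥ᶠ          = false
occF c (B ∧ᶠ D)    = occF c B || occF c D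
occF c (B ∨ᶠ D)    = occF c B || occF c D
occF c (B ⊃ᶠ D)    = occF c B || occF c D
occF c (∀ᶠ B)      = occF c B
occF c (∃ᶠ B)      = occF c B

FreshIn : ℕ → List (Formula 0) → Set
FreshIn c Γ = All (λ F → occF c F ≡ false) Γ

data IsAtomic {n} : Formula n → Set where
  atomic : ∀ p ts → IsAtomic (atom p ts)

data IsA {n} : Formula n → Set where
  a-atom : ∀ {F} → IsAtomic F → IsA F
  a-⊤    : IsA ⊤ᶠ
  a-⊥    : IsA ⊥ᶠ

data IsAtomOrBot {n} : Formula n → Set where
  ab-atom : ∀ {F} → IsAtomic F → IsAtomOrBot F
  ab-⊥    : IsAtomOrBot ⊥ᶠ

data IsDisj {n} : Formula n → List (Formula n) → Set where
  disj-leaf : ∀ {A} → IsA A → IsDisj A (A ∷ [])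
  disj-or   : ∀ {F F' As As'} → IsDisj F As → IsDisj F' As' →
              IsDisj (F ∨ᶠ F') (As ++ As')

mutual
  data IsGoal {n} : Formula n → Set where
    g-A   : ∀ {A} → IsA A → IsGoal A
    g-and : ∀ {G G'} → IsGoal G → IsGoal G' → IsGoal (G ∧ᶠ G')
    g-or  : ∀ {G G'} → IsGoal G → IsGoal G' → IsGoal (G ∨ᶠ G')
    g-imp : ∀ {D G} → IsClause D → IsGoal G → IsGoal (D ⊃ᶠ G)
    g-ex  : ∀ {G} → IsGoal G → IsGoal (∃ᶠ G)

  data IsClause {n} : Formula n → Set where
    d-disj : ∀ {F As} → IsDisj F As → IsClause F
    d-imp  : ∀ {G F As} → IsGoal G → IsDisj F As → IsClause (G ⊃ᶠ F)
    d-all  : ∀ {D} → IsClause D → IsClause (∀ᶠ D)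

-- Clause instances:  Inst D h As  means  ⟨h, {As}⟩ ∈ [D]
-- (h = nothing for ∅, h = just G' for {G'}); As is the list of disjuncts,
-- compared as a set below.  Terms t are closed terms.

data Inst : Formula 0 → Maybe (Formula 0) → List (Formula 0) → Set where
  inst-disj : ∀ {F As} → IsDisj F As → Inst F nothing As
  inst-imp  : ∀ {G' F As} → IsDisj F As → Inst (G' ⊃ᶠ F) (just G') As
  inst-all  : ∀ {B h As} (t : Term 0) → Inst (B [ t ]) h As → Inst (∀ᶠ B) h As

SameSet : List (Formula 0) → List (Formula 0) → Set
SameSet L M = ∀ x → (x ∈ L → x ∈ M) × (x ∈ M → x ∈ L)

InstIn : List (Formula 0) → Maybe (Formula 0) → Formula 0 → List (Formula 0) → Set
InstIn Γ h C As =
  Σ (Formula 0) λ D → D ∈ Γ × Σ (List (Formula 0)) λ Bs → Inst D h Bs ×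
    (SameSet Bs (C ∷ As) ⊎ SameSet Bs (⊥ᶠ ∷ As))

-- C-proofs: classical multiple-succedent sequent calculus.
-- Sequents are pairs of lists read as multisets (rule cp-perm); the
-- principal formula is written at the head of its list.

Ctx : Set
Ctx = List (Formula 0)

data CProof : Ctx → Ctx → Set where
  cp-perm  : ∀ {Γ Γ' Δ Δ'} → Γ ↭ Γ' → Δ ↭ Δ' → CProof Γ Δ → CProof Γ' Δ'
  cp-ax⊤   : ∀ {Γ Δ} → ⊤ᶠ ∈ Δ → CProof Γ Δ
  cp-ax    : ∀ {Γ Δ A} → IsAtomOrBot A → A ∈ Γ → A ∈ Δ → CProof Γ Δ
  cp-contrL : ∀ {Γ Δ B} → CProof (B ∷ B ∷ Γ) Δ → CProof (B ∷ Γ) Δ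
  cp-contrR : ∀ {Γ Δ B} → CProof Γ (B ∷ B ∷ Δ) → CProof Γ (B ∷ Δ)
  cp-⊥R    : ∀ {Γ Δ D} → CProof Γ (⊥ᶠ ∷ Δ) → CProof Γ (D ∷ Δ)
  cp-∧L    : ∀ {Γ Δ B D} → CProof (B ∷ D ∷ (B ∧ᶠ D) ∷ Γ) Δ → CProof ((B ∧ᶠ D) ∷ Γ) Δ
  cp-∧R    : ∀ {Γ Δ B D} → CProof Γ (B ∷ Δ) → CProof Γ (D ∷ Δ) → CProof Γ ((B ∧ᶠ D) ∷ Δ)
  cp-∨L    : ∀ {Γ Δ B D} → CProof (B ∷ Γ) Δ → CProof (D ∷ Γ) Δ → CProof ((B ∨ᶠ D) ∷ Γ) Δ
  cp-∨R₁   : ∀ {Γ Δ B D} → CProof Γ (B ∷ Δ) → CProof Γ ((B ∨ᶠ D) ∷ Δ)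
  cp-∨R₂   : ∀ {Γ Δ B D} → CProof Γ (D ∷ Δ) → CProof Γ ((B ∨ᶠ D) ∷ Δ)
  cp-⊃L    : ∀ {Γ Δ Θ B D} → CProof ((B ⊃ᶠ D) ∷ Γ) (B ∷ Δ) → CProof (D ∷ Γ) Θ →
             CProof ((B ⊃ᶠ D) ∷ Γ) (Δ ++ Θ)
  cp-⊃R    : ∀ {Γ Δ B D} → CProof (B ∷ Γ) (D ∷ Δ) → CProof Γ ((B ⊃ᶠ D) ∷ Δ)
  cp-∀L    : ∀ {Γ Δ B} (t : Term 0) → CProof ((B [ t ]) ∷ ∀ᶠ B ∷ Γ) Δ → CProof (∀ᶠ B ∷ Γ) Δ
  cp-∃R    : ∀ {Γ Δ B} (t : Term 0) → CProof Γ ((B [ t ]) ∷ Δ) → CProof Γ (∃ᶠ B ∷ Δ)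
  cp-∃L    : ∀ {Γ Δ B} (c : ℕ) → FreshIn c ((∃ᶠ B ∷ Γ) ++ Δ) →
             CProof ((B [ const c ]) ∷ Γ) Δ → CProof (∃ᶠ B ∷ Γ) Δ
  cp-∀R    : ∀ {Γ Δ B} (c : ℕ) → FreshIn c (Γ ++ (∀ᶠ B ∷ Δ)) →
             CProof Γ ((B [ const c ]) ∷ Δ) → CProof Γ (∀ᶠ B ∷ Δ)

data Red (G : Formula 0) : Ctx → Formula 0 → Set where
  r-⊤         : ∀ {Δ} → Red G Δ ⊤ᶠ
  r-restart   : ∀ {Γ C} → IsAtomOrBot C → Red G Γ G → Red G Γ C
  r-atomic    : ∀ {Γ C} (As : List (Formula 0)) → IsAtomOrBot C →
                InstIn Γ nothing C As →
                All (λ A → Red G (A ∷ Γ) G) As → Red G Γ C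
  r-backchain : ∀ {Γ C} (G' : Formula 0) (As : List (Formula 0)) → IsAtomOrBot C →
                InstIn Γ (just G') C As → Red G Γ G' →
                All (λ A → Red G (A ∷ Γ) G) As → Red G Γ C
  r-∨R₁       : ∀ {Δ B D} → Red G Δ B → Red G Δ (B ∨ᶠ D)
  r-∨R₂       : ∀ {Δ B D} → Red G Δ D → Red G Δ (B ∨ᶠ D)
  r-∧R        : ∀ {Δ B D} → Red G Δ B → Red G Δ D → Red G Δ (B ∧ᶠ D)
  r-⊃R        : ∀ {Δ B D} → Red G (B ∷ Δ) D → Red G Δ (B ⊃ᶠ D)
  r-∃R        : ∀ {Δ B} (t : Term 0) → Red G Δ (B [ t ]) → Red G Δ (∃ᶠ B)

{-# OPTIONS --safe #-}
module Submission where

-- Soundness: every rule of the reduced system is derivable in the C-calculus once the goal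
-- G is kept as an extra succedent formula; RESTART is then a contraction on G.
--
-- Completeness: by induction on a C-proof of Γ ⟶ Δ, G has a reduced proof as soon as every
-- F ∈ Δ reduces to G, i.e. every reduced proof of F over an extension of the context yields
-- one of G. The right rules are absorbed into these continuations: ⊥-R because a reduced
-- proof of ⊥ gives one of every goal, ⊃-R because RESTART gives every goal from G. A left
-- rule replaces a clause by a component (an instance, a disjunct, the head of an
-- implication); this is harmless for reduced proofs because every ATOMIC or BACKCHAIN step
-- through the component is simulated by one through the whole clause: for ⊃-L the left
-- premise supplies the BACKCHAIN premise, for ∨-L the disjuncts of the other side become
-- extra ATOMIC branches, closed by the right premise.

open import Defs
open import Data.Fin using (Fin)
open import Data.List using (List; []; _∷_; _++_)
open import Data.List.Membership.Propositional using (_∈_)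
open import Data.List.Membership.Propositional.Properties using (∈-++⁺ˡ; ∈-++⁺ʳ; ∈-++⁻; ∈-∃++)
open import Data.List.Relation.Binary.Permutation.Propositional using (_↭_; prep; swap; ↭-refl; ↭-sym)
open import Data.List.Relation.Binary.Permutation.Propositional.Properties using (All-resp-↭; shift)
open import Data.List.Relation.Binary.Subset.Propositional using (_⊆_)
open import Data.List.Relation.Binary.Subset.Propositional.Properties
  using (⊆-refl; ⊆-trans; ⊆-reflexive-↭; xs⊆x∷xs; ∷⁺ʳ; ∈-∷⁺ʳ)
open import Data.List.Relation.Unary.All using (All; []; _∷_; lookup; tabulate)
import Data.List.Relation.Unary.All as All
open import Data.List.Relation.Unary.All.Properties using (++⁺; ++⁻)
open import Data.List.Relation.Unary.Any using (here; there)
open import Data.Maybe using (Maybe; just; nothing)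
open import Data.Product using (∃; _×_; _,_; proj₁; proj₂)
open import Data.Sum using (_⊎_; inj₁; inj₂)
import Data.Sum as Sum
open import Data.Unit using (⊤; tt)
open import Function.Bundles using (_⇔_; mk⇔)
open import Relation.Binary.PropositionalEquality using (_≡_; refl; cong; cong₂; trans)

private
  variable
    Γ Γ' Δ Θ : Ctx
    As Bs Ls L₁ L₂ : List (Formula 0)
    A B C D F X Y : Formula 0
    h : Maybe (Formula 0)

∈⇒↭∷ : ∀ {a} {S : Set a} {x : S} {xs} → x ∈ xs → ∃ λ ys → xs ↭ x ∷ ys
∈⇒↭∷ x∈xs with ys , zs , refl ← ∈-∃++ x∈xs = ys ++ zs , shift _ ys zs

∷⊆⇒⊆ : ∀ {a} {S : Set a} {x : S} {xs ys} → x ∷ xs ⊆ ys → xs ⊆ ys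
∷⊆⇒⊆ s = ⊆-trans (xs⊆x∷xs _ _) s

SameSet-refl : SameSet L₁ L₁
SameSet-refl x = (λ m → m) , (λ m → m)

SameSet-++ : ∀ M → SameSet L₁ (Y ∷ As) → SameSet (L₁ ++ M) (Y ∷ As ++ M)
SameSet-++ {L₁} {Y} {As} M same x = to , from
  where
  to : x ∈ L₁ ++ M → x ∈ Y ∷ As ++ M
  to m with ∈-++⁻ L₁ m
  ... | inj₂ k = there (∈-++⁺ʳ As k)
  ... | inj₁ k with proj₁ (same x) k
  ...   | here eq = here eq
  ...   | there j = there (∈-++⁺ˡ j)
  from : x ∈ Y ∷ As ++ M → x ∈ L₁ ++ M
  from (here eq) = ∈-++⁺ˡ (proj₂ (same x) (here eq))
  from (there k) with ∈-++⁻ As k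
  ... | inj₁ j = ∈-++⁺ˡ (proj₂ (same x) (there j))
  ... | inj₂ j = ∈-++⁺ʳ L₁ j

Matches : List (Formula 0) → Formula 0 → List (Formula 0) → Set
Matches Bs C As = SameSet Bs (C ∷ As) ⊎ SameSet Bs (⊥ᶠ ∷ As)

Matches-∈ : Matches Bs C As → B ∈ Bs → B ≡ C ⊎ B ≡ ⊥ᶠ ⊎ B ∈ As
Matches-∈ (inj₁ same) m with proj₁ (same _) m
... | here eq = inj₁ eq
... | there k = inj₂ (inj₂ k)
Matches-∈ (inj₂ same) m with proj₁ (same _) m
... | here eq = inj₂ (inj₁ eq)
... | there k = inj₂ (inj₂ k)

IsAtomOrBot⇒IsA : ∀ {n} {C : Formula n} → IsAtomOrBot C → IsA C
IsAtomOrBot⇒IsA (ab-atom a) = a-atom a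
IsAtomOrBot⇒IsA ab-⊥        = a-⊥

IsA-subF : ∀ {m n} (σ : Fin m → Term n) {F} → IsA F → IsA (subF σ F)
IsA-subF σ (a-atom (atomic p ts)) = a-atom (atomic p _)
IsA-subF σ a-⊤                    = a-⊤
IsA-subF σ a-⊥                    = a-⊥

IsDisj-subF : ∀ {m n} (σ : Fin m → Term n) {F As} → IsDisj F As →
              ∃ λ Bs → IsDisj (subF σ F) Bs
IsDisj-subF σ (disj-leaf a)   = _ , disj-leaf (IsA-subF σ a)
IsDisj-subF σ (disj-or d₁ d₂) = _ , disj-or (proj₂ (IsDisj-subF σ d₁)) (proj₂ (IsDisj-subF σ d₂))

mutual
  IsGoal-subF : ∀ {m n} (σ : Fin m → Term n) {F} → IsGoal F → IsGoal (subF σ F)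
  IsGoal-subF σ (g-A a)      = g-A (IsA-subF σ a)
  IsGoal-subF σ (g-and g g') = g-and (IsGoal-subF σ g) (IsGoal-subF σ g')
  IsGoal-subF σ (g-or g g')  = g-or (IsGoal-subF σ g) (IsGoal-subF σ g')
  IsGoal-subF σ (g-imp c g)  = g-imp (IsClause-subF σ c) (IsGoal-subF σ g)
  IsGoal-subF σ (g-ex g)     = g-ex (IsGoal-subF (lift σ) g)

  IsClause-subF : ∀ {m n} (σ : Fin m → Term n) {F} → IsClause F → IsClause (subF σ F)
  IsClause-subF σ (d-disj d)  = d-disj (proj₂ (IsDisj-subF σ d))
  IsClause-subF σ (d-imp g d) = d-imp (IsGoal-subF σ g) (proj₂ (IsDisj-subF σ d))
  IsClause-subF σ (d-all c)   = d-all (IsClause-subF (lift σ) c)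

IsDisj-functional : ∀ {n} {F : Formula n} {As Bs} → IsDisj F As → IsDisj F Bs → As ≡ Bs
IsDisj-functional (disj-leaf _)           (disj-leaf _)   = refl
IsDisj-functional (disj-leaf (a-atom ())) (disj-or _ _)
IsDisj-functional (disj-or _ _)           (disj-leaf (a-atom ()))
IsDisj-functional (disj-or d₁ d₂)         (disj-or e₁ e₂) =
  cong₂ _++_ (IsDisj-functional d₁ e₁) (IsDisj-functional d₂ e₂)

Inst-IsDisj : IsDisj F Ls → Inst F h Bs → h ≡ nothing × Bs ≡ Ls
Inst-IsDisj d                       (inst-disj d') = refl , IsDisj-functional d' d
Inst-IsDisj (disj-leaf (a-atom ())) (inst-imp _)
Inst-IsDisj (disj-leaf (a-atom ())) (inst-all _ _)

-- Substitution preserves the shape of a formula, so goals can be decomposed by recursion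
-- on shapes even through the instantiation of an existential.
data Shape : Set where
  leaf  : Shape
  node₁ : Shape → Shape
  node₂ : Shape → Shape → Shape

node₁-injective : ∀ {s s'} → node₁ s ≡ node₁ s' → s ≡ s'
node₁-injective refl = refl

node₂-injectiveˡ : ∀ {s₁ s₂ s₁' s₂'} → node₂ s₁ s₂ ≡ node₂ s₁' s₂' → s₁ ≡ s₁'
node₂-injectiveˡ refl = refl

node₂-injectiveʳ : ∀ {s₁ s₂ s₁' s₂'} → node₂ s₁ s₂ ≡ node₂ s₁' s₂' → s₂ ≡ s₂'
node₂-injectiveʳ refl = refl

shape : ∀ {n} → Formula n → Shape
shape (atom _ _) = leaf
shape ⊤ᶠ         = leaf
shape ⊥ᶠ         = leaf
shape (B ∧ᶠ D)   = node₂ (shape B) (shape D)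
shape (B ∨ᶠ D)   = node₂ (shape B) (shape D)
shape (B ⊃ᶠ D)   = node₂ (shape B) (shape D)
shape (∀ᶠ B)     = node₁ (shape B)
shape (∃ᶠ B)     = node₁ (shape B)

shape-subF : ∀ {m n} (σ : Fin m → Term n) (F : Formula m) → shape (subF σ F) ≡ shape F
shape-subF σ (atom _ _) = refl
shape-subF σ ⊤ᶠ         = refl
shape-subF σ ⊥ᶠ         = refl
shape-subF σ (B ∧ᶠ D)   = cong₂ node₂ (shape-subF σ B) (shape-subF σ D)
shape-subF σ (B ∨ᶠ D)   = cong₂ node₂ (shape-subF σ B) (shape-subF σ D)
shape-subF σ (B ⊃ᶠ D)   = cong₂ node₂ (shape-subF σ B) (shape-subF σ D)
shape-subF σ (∀ᶠ B)     = cong node₁ (shape-subF (lift σ) B)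
shape-subF σ (∃ᶠ B)     = cong node₁ (shape-subF (lift σ) B)

cp-swapR : CProof Γ (X ∷ Y ∷ Θ) → CProof Γ (Y ∷ X ∷ Θ)
cp-swapR {X = X} {Y} = cp-perm ↭-refl (swap X Y ↭-refl)

cp-contrR-past : CProof Γ (X ∷ Y ∷ X ∷ Θ) → CProof Γ (Y ∷ X ∷ Θ)
cp-contrR-past {X = X} {Y} d = cp-swapR (cp-contrR (cp-perm ↭-refl (prep X (swap Y X ↭-refl)) d))

cp-focusL : D ∈ Γ → (∀ {R} → Γ ⊆ D ∷ R → CProof (D ∷ R) Δ) → CProof Γ Δ
cp-focusL m k with _ , p ← ∈⇒↭∷ m = cp-perm (↭-sym p) ↭-refl (k (⊆-reflexive-↭ p))

cp-∨L* : IsDisj F Bs → (∀ {B} → B ∈ Bs → CProof (B ∷ Γ) Δ) → CProof (F ∷ Γ) Δ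
cp-∨L* (disj-leaf _)               k = k (here refl)
cp-∨L* (disj-or {As = As} d₁ d₂) k =
  cp-∨L (cp-∨L* d₁ (λ m → k (∈-++⁺ˡ m))) (cp-∨L* d₂ (λ m → k (∈-++⁺ʳ As m)))

-- The quantifier-free clause that yields the instance ⟨h, Bs⟩, for F a disjunction of Bs.
Head : Maybe (Formula 0) → Formula 0 → Formula 0
Head nothing   F = F
Head (just G') F = G' ⊃ᶠ F

cp-instantiate : Inst D h Bs → D ∈ Γ →
                 (∀ {Γ'} → Γ ⊆ Γ' → ∀ {F} → IsDisj F Bs → Head h F ∈ Γ' → CProof Γ' Δ) →
                 CProof Γ Δ
cp-instantiate (inst-disj d)  m k = k ⊆-refl d m
cp-instantiate (inst-imp d)   m k = k ⊆-refl d m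
cp-instantiate (inst-all t i) m k = cp-focusL m λ s →
  cp-∀L t (cp-instantiate i (here refl) λ s' → k (⊆-trans s (∷⊆⇒⊆ s')))

module _ (G : Formula 0) where

  Premise : Maybe (Formula 0) → Ctx → Set
  Premise nothing   Γ = ⊤
  Premise (just G') Γ = Red G Γ G'

  Branches : Ctx → List (Formula 0) → Set
  Branches Γ As = All (λ A → Red G (A ∷ Γ) G) As

  r-instance : D ∈ Γ → Inst D h Bs → IsAtomOrBot C → Matches Bs C As →
               Premise h Γ → Branches Γ As → Red G Γ C
  r-instance {h = nothing} {As = As} m i c ms _  bs = r-atomic As c (_ , m , _ , i , ms) bs
  r-instance {h = just G'} {As = As} m i c ms rG bs = r-backchain G' As c (_ , m , _ , i , ms) rG bs

  -- Every ATOMIC or BACKCHAIN step through an instance of D is admissible over every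
  -- extension of Γ, even if D itself is absent.
  Admissible : Formula 0 → Ctx → Set
  Admissible D Γ = ∀ {h Bs C As} → Inst D h Bs → IsAtomOrBot C → Matches Bs C As →
                   ∀ {Γ'} → Γ ⊆ Γ' → Premise h Γ' → Branches Γ' As → Red G Γ' C

  Admissible-⊆ : Γ ⊆ Γ' → Admissible D Γ → Admissible D Γ'
  Admissible-⊆ s adm i c ms s' = adm i c ms (⊆-trans s s')

  ∈⇒Admissible : D ∈ Γ → Admissible D Γ
  ∈⇒Admissible m i c ms s = r-instance (s m) i c ms

  _≼_ : Ctx → Ctx → Set
  Γ ≼ Γ' = ∀ {D} → D ∈ Γ → Admissible D Γ'

  ⊆⇒≼ : Γ ⊆ Γ' → Γ ≼ Γ'
  ⊆⇒≼ s m = ∈⇒Admissible (s m)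

  ≼-∷ˡ : Admissible D Γ' → Γ ≼ Γ' → (D ∷ Γ) ≼ Γ'
  ≼-∷ˡ adm le (here refl) = adm
  ≼-∷ˡ adm le (there m)   = le m

  ≼-∷ : Γ ≼ Γ' → (D ∷ Γ) ≼ (D ∷ Γ')
  ≼-∷ le = ≼-∷ˡ (∈⇒Admissible (here refl)) (λ m → Admissible-⊆ (xs⊆x∷xs _ _) (le m))

  mutual
    Red-≼ : Red G Γ X → Γ ≼ Γ' → Red G Γ' X
    Red-≼ r-⊤                                        le = r-⊤
    Red-≼ (r-restart c r)                            le = r-restart c (Red-≼ r le)
    Red-≼ (r-atomic _ c (_ , m , _ , i , ms) bs)     le = le m i c ms ⊆-refl tt (Branches-≼ bs le)
    Red-≼ (r-backchain _ _ c (_ , m , _ , i , ms) r bs) le =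
      le m i c ms ⊆-refl (Red-≼ r le) (Branches-≼ bs le)
    Red-≼ (r-∨R₁ r)                                  le = r-∨R₁ (Red-≼ r le)
    Red-≼ (r-∨R₂ r)                                  le = r-∨R₂ (Red-≼ r le)
    Red-≼ (r-∧R r r')                                le = r-∧R (Red-≼ r le) (Red-≼ r' le)
    Red-≼ (r-⊃R r)                                   le = r-⊃R (Red-≼ r (≼-∷ le))
    Red-≼ (r-∃R t r)                                 le = r-∃R t (Red-≼ r le)

    Branches-≼ : Branches Γ As → Γ ≼ Γ' → Branches Γ' As
    Branches-≼ []       le = []
    Branches-≼ (b ∷ bs) le = Red-≼ b (≼-∷ le) ∷ Branches-≼ bs le

  Red-⊆ : Red G Γ X → Γ ⊆ Γ' → Red G Γ' X
  Red-⊆ r s = Red-≼ r (⊆⇒≼ s)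

  Red-discharge : Admissible D Γ → Red G (D ∷ Γ) X → Red G Γ X
  Red-discharge adm r = Red-≼ r (≼-∷ˡ adm (⊆⇒≼ ⊆-refl))

  Red-⊥⇒ : Red G Γ ⊥ᶠ → IsAtomOrBot C → Red G Γ C
  Red-⊥⇒ (r-restart _ r)                            c = r-restart c r
  Red-⊥⇒ (r-atomic As _ (_ , m , _ , i , ms) bs)    c =
    r-atomic As c (_ , m , _ , i , inj₂ (Sum.reduce ms)) bs
  Red-⊥⇒ (r-backchain G' As _ (_ , m , _ , i , ms) r bs) c =
    r-backchain G' As c (_ , m , _ , i , inj₂ (Sum.reduce ms)) r bs

  r-assumption : A ∈ Γ → IsAtomOrBot A → Red G Γ A
  r-assumption m c =
    r-atomic [] c (_ , m , _ , inst-disj (disj-leaf (IsAtomOrBot⇒IsA c)) , inj₁ SameSet-refl) []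

  ∀-instance-Admissible : ∀ {B : Formula 1} → ∀ᶠ B ∈ Γ → (t : Term 0) → Admissible (B [ t ]) Γ
  ∀-instance-Admissible m t i = ∈⇒Admissible m (inst-all t i)

  disjunct-Admissible : IsDisj D Ls → A ∈ Ls → A ∈ Γ → Admissible D Γ
  disjunct-Admissible dD mA mΓ i c ms s _ bs with refl , refl ← Inst-IsDisj dD i | Matches-∈ ms mA
  ... | inj₁ refl        = r-assumption (s mΓ) c
  ... | inj₂ (inj₁ refl) = Red-⊥⇒ (r-assumption (s mΓ) ab-⊥) c
  ... | inj₂ (inj₂ k)    = r-restart c (Red-⊆ (lookup bs k) (∈-∷⁺ʳ (s mΓ) ⊆-refl))

  -- A step through B is made through B ∨ D with the disjuncts of D as extra branches; in
  -- the branch for a disjunct of D, D itself is admissible.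
  ∨-left-Admissible : IsDisj B L₁ → IsDisj D L₂ → (B ∨ᶠ D) ∈ Γ →
                      (∀ {Γ'} → Γ ⊆ Γ' → Red G (D ∷ Γ') G) → Admissible B Γ
  ∨-left-Admissible {L₂ = L₂} dB dD m rD i c ms s _ bs with refl , refl ← Inst-IsDisj dB i =
    r-atomic _ c (_ , s m , _ , inst-disj (disj-or dB dD) , Sum.map (SameSet-++ L₂) (SameSet-++ L₂) ms)
      (++⁺ bs (tabulate λ k →
        Red-discharge (disjunct-Admissible dD k (here refl)) (Red-⊆ (rD s) (∷⁺ʳ _ (xs⊆x∷xs _ _)))))

  ⊃-head-Admissible : IsDisj D Ls → (B ⊃ᶠ D) ∈ Γ → Red G Γ B → Admissible D Γ
  ⊃-head-Admissible dD m rB i c ms s _ bs with refl , refl ← Inst-IsDisj dD i =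
    r-backchain _ _ c (_ , s m , _ , inst-imp dD , ms) (Red-⊆ rB s) bs

  AtomsDerivable : Ctx → Set
  AtomsDerivable Γ = ∀ {Γ'} → Γ ⊆ Γ' → ∀ {C} → IsAtomOrBot C → Red G Γ' C

  Red-goal-by-shape : ∀ s → shape F ≡ s → AtomsDerivable Γ → IsGoal F → Red G Γ F
  Red-goal-by-shape _ _ at (g-A (a-atom a)) = at ⊆-refl (ab-atom a)
  Red-goal-by-shape _ _ at (g-A a-⊤)        = r-⊤
  Red-goal-by-shape _ _ at (g-A a-⊥)        = at ⊆-refl ab-⊥
  Red-goal-by-shape (node₂ s s') eq at (g-and g g') =
    r-∧R (Red-goal-by-shape s (node₂-injectiveˡ eq) at g)
         (Red-goal-by-shape s' (node₂-injectiveʳ eq) at g')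
  Red-goal-by-shape (node₂ s _) eq at (g-or g _) = r-∨R₁ (Red-goal-by-shape s (node₂-injectiveˡ eq) at g)
  Red-goal-by-shape (node₂ _ s') eq at (g-imp _ g) =
    r-⊃R (Red-goal-by-shape s' (node₂-injectiveʳ eq) (λ s → at (∷⊆⇒⊆ s)) g)
  Red-goal-by-shape (node₁ s) eq at (g-ex {G = B} g) =
    r-∃R (const 0)
      (Red-goal-by-shape s (trans (shape-subF _ B) (node₁-injective eq)) at (IsGoal-subF _ g))

  Red-goal : AtomsDerivable Γ → IsGoal F → Red G Γ F
  Red-goal = Red-goal-by-shape _ refl

  Red-restart-goal : Red G Γ G → IsGoal F → Red G Γ F
  Red-restart-goal r = Red-goal λ s c → r-restart c (Red-⊆ r s)

  Red-⊥-goal : Red G Γ ⊥ᶠ → IsGoal F → Red G Γ F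
  Red-⊥-goal r = Red-goal λ s → Red-⊥⇒ (Red-⊆ r s)

  Reduces : Ctx → Formula 0 → Set
  Reduces Γ F = ∀ {Γ'} → Γ ⊆ Γ' → Red G Γ' F → Red G Γ' G

  Reduces-⊆ : Γ ⊆ Γ' → Reduces Γ F → Reduces Γ' F
  Reduces-⊆ s red s' = red (⊆-trans s s')

  Reduces-∷ : All (Reduces Γ) Δ → All (Reduces (B ∷ Γ)) Δ
  Reduces-∷ = All.map (Reduces-⊆ (xs⊆x∷xs _ _))

  Reduces-⊥ : IsGoal F → Reduces Γ F → Reduces Γ ⊥ᶠ
  Reduces-⊥ g red s r = red s (Red-⊥-goal r g)

  Reduces-∧ : Reduces Γ (B ∧ᶠ D) → Red G Γ B → Reduces Γ D
  Reduces-∧ red rB s rD = red s (r-∧R (Red-⊆ rB s) rD)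

  Reduces-∨ˡ : Reduces Γ (B ∨ᶠ D) → Reduces Γ B
  Reduces-∨ˡ red s r = red s (r-∨R₁ r)

  Reduces-∨ʳ : Reduces Γ (B ∨ᶠ D) → Reduces Γ D
  Reduces-∨ʳ red s r = red s (r-∨R₂ r)

  Reduces-⊃ : Reduces Γ (B ⊃ᶠ D) → Reduces (B ∷ Γ) D
  Reduces-⊃ red s r = red (∷⊆⇒⊆ s) (r-⊃R (Red-⊆ r (xs⊆x∷xs _ _)))

  Reduces-∃ : ∀ {B : Formula 1} (t : Term 0) → Reduces Γ (∃ᶠ B) → Reduces Γ (B [ t ])
  Reduces-∃ t red s r = red s (r-∃R t r)

  complete : CProof Γ Δ → All IsClause Γ → All IsGoal Δ → Γ ⊆ Γ' → All (Reduces Γ') Δ → Red G Γ' G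
  complete (cp-perm pΓ pΔ d) cs gs s reds =
    complete d (All-resp-↭ (↭-sym pΓ) cs) (All-resp-↭ (↭-sym pΔ) gs) (⊆-trans (⊆-reflexive-↭ pΓ) s)
      (All-resp-↭ (↭-sym pΔ) reds)
  complete (cp-ax⊤ m)       _ _ _ reds = lookup reds m ⊆-refl r-⊤
  complete (cp-ax c mΓ mΔ)  _ _ s reds = lookup reds mΔ ⊆-refl (r-assumption (s mΓ) c)
  complete (cp-contrL d) (c ∷ cs) gs s reds = complete d (c ∷ c ∷ cs) gs (∈-∷⁺ʳ (s (here refl)) s) reds
  complete (cp-contrR d) cs (g ∷ gs) s (red ∷ reds) = complete d cs (g ∷ g ∷ gs) s (red ∷ red ∷ reds)
  complete (cp-⊥R d) cs (g ∷ gs) s (red ∷ reds) = complete d cs (g-A a-⊥ ∷ gs) s (Reduces-⊥ g red ∷ reds)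
  complete (cp-∧L _) (d-disj (disj-leaf (a-atom ())) ∷ _) _ _ _
  complete (cp-∧R _ _) _ (g-A (a-atom ()) ∷ _) _ _
  complete {Γ' = Γ'} (cp-∧R {B = B} d d') cs (g-and g g' ∷ gs) s (red ∷ reds) =
    complete d cs (g ∷ gs) s (redB ∷ reds)
    where
    redB : Reduces Γ' B
    redB s' rB = complete d' cs (g' ∷ gs) (⊆-trans s s')
                   (Reduces-∧ (Reduces-⊆ s' red) rB ∷ All.map (Reduces-⊆ s') reds)
  complete (cp-∨L _ _) (d-disj (disj-leaf (a-atom ())) ∷ _) _ _ _
  complete {Γ' = Γ'} (cp-∨L {D = D} d d') (d-disj (disj-or dB dD) ∷ cs) gs s reds =
    Red-discharge (∨-left-Admissible dB dD (s (here refl)) rD)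
      (complete d (d-disj dB ∷ cs) gs (∷⁺ʳ _ (∷⊆⇒⊆ s)) (Reduces-∷ reds))
    where
    rD : ∀ {Γ''} → Γ' ⊆ Γ'' → Red G (D ∷ Γ'') G
    rD s' = complete d' (d-disj dD ∷ cs) gs (∷⁺ʳ _ (∷⊆⇒⊆ (⊆-trans s s')))
              (Reduces-∷ (All.map (Reduces-⊆ s') reds))
  complete (cp-∨R₁ _) _ (g-A (a-atom ()) ∷ _) _ _
  complete (cp-∨R₁ d) cs (g-or g _ ∷ gs) s (red ∷ reds) = complete d cs (g ∷ gs) s (Reduces-∨ˡ red ∷ reds)
  complete (cp-∨R₂ _) _ (g-A (a-atom ()) ∷ _) _ _
  complete (cp-∨R₂ d) cs (g-or _ g ∷ gs) s (red ∷ reds) = complete d cs (g ∷ gs) s (Reduces-∨ʳ red ∷ reds)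
  complete (cp-⊃L _ _) (d-disj (disj-leaf (a-atom ())) ∷ _) _ _ _
  complete {Γ' = Γ'} (cp-⊃L {Δ = Δ} {B = B} d d') (d-imp g dD ∷ cs) gs s reds
    with gsΔ , gsΘ ← ++⁻ Δ gs | redsΔ , redsΘ ← ++⁻ Δ reds =
    complete d (d-imp g dD ∷ cs) (g ∷ gsΔ) s (redB ∷ redsΔ)
    where
    redB : Reduces Γ' B
    redB s' rB = Red-discharge (⊃-head-Admissible dD (s' (s (here refl))) rB)
                   (complete d' (d-disj dD ∷ cs) gsΘ (∷⁺ʳ _ (∷⊆⇒⊆ (⊆-trans s s')))
                      (Reduces-∷ (All.map (Reduces-⊆ s') redsΘ)))
  complete (cp-⊃R _) _ (g-A (a-atom ()) ∷ _) _ _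
  complete {Γ' = Γ'} (cp-⊃R {B = B} d) cs (g-imp c g ∷ gs) s (red ∷ reds) =
    red ⊆-refl (r-⊃R (Red-restart-goal rG g))
    where
    rG : Red G (B ∷ Γ') G
    rG = complete d (c ∷ cs) (g ∷ gs) (∷⁺ʳ _ s) (Reduces-⊃ red ∷ Reduces-∷ reds)
  complete (cp-∀L _ _) (d-disj (disj-leaf (a-atom ())) ∷ _) _ _ _
  complete (cp-∀L t d) (d-all c ∷ cs) gs s reds =
    Red-discharge (∀-instance-Admissible (s (here refl)) t)
      (complete d (IsClause-subF _ c ∷ d-all c ∷ cs) gs (∷⁺ʳ _ s) (Reduces-∷ reds))
  complete (cp-∃R _ _) _ (g-A (a-atom ()) ∷ _) _ _
  complete (cp-∃R t d) cs (g-ex g ∷ gs) s (red ∷ reds) =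
    complete d cs (IsGoal-subF _ g ∷ gs) s (Reduces-∃ t red ∷ reds)
  complete (cp-∃L _ _ _) (d-disj (disj-leaf (a-atom ())) ∷ _) _ _ _
  complete (cp-∀R _ _ _) _ (g-A (a-atom ()) ∷ _) _ _

  -- Weakening on both sides is built in: the C-calculus has no weakening rule.
  Sound : Ctx → Formula 0 → Set
  Sound Γ F = ∀ {Γ'} Θ → Γ ⊆ Γ' → CProof Γ' (F ∷ G ∷ Θ)

  SoundPremise : Maybe (Formula 0) → Ctx → Set
  SoundPremise nothing   Γ = ⊤
  SoundPremise (just G') Γ = Sound Γ G'

  SoundBranches : Ctx → List (Formula 0) → Set
  SoundBranches Γ As = All (λ A → Sound (A ∷ Γ) G) As

  cp-branch : IsAtomOrBot C → Matches Bs C As → SoundBranches Γ As → Γ ⊆ Γ' → B ∈ Bs →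
              CProof (B ∷ Γ') (C ∷ G ∷ Θ)
  cp-branch c ms bs s mB with Matches-∈ ms mB
  ... | inj₁ refl        = cp-ax c (here refl) (here refl)
  ... | inj₂ (inj₁ refl) = cp-⊥R (cp-ax ab-⊥ (here refl) (here refl))
  ... | inj₂ (inj₂ k)    = cp-swapR (cp-contrR (lookup bs k _ (∷⁺ʳ _ s)))

  cp-use-head : ∀ h → IsDisj F Bs → IsAtomOrBot C → Matches Bs C As → SoundPremise h Γ →
            SoundBranches Γ As → Γ ⊆ Head h F ∷ Γ' → CProof (Head h F ∷ Γ') (C ∷ G ∷ Θ)
  cp-use-head nothing   dF c ms _  bs s = cp-contrL (cp-∨L* dF (cp-branch c ms bs s))
  cp-use-head (just G') dF c ms sG bs s = cp-contrL (cp-contrR-past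
    (cp-⊃L {Δ = G ∷ []} (sG [] (⊆-trans s (xs⊆x∷xs _ _))) (cp-∨L* dF (cp-branch c ms bs s))))

  Sound-instance : D ∈ Γ → Inst D h Bs → IsAtomOrBot C → Matches Bs C As →
                   SoundPremise h Γ → SoundBranches Γ As → Sound Γ C
  Sound-instance {h = h} m i c ms sP bs Θ s =
    cp-instantiate i (s m) λ s' dF mF → cp-focusL mF λ s'' →
      cp-use-head h dF c ms sP bs (⊆-trans s (⊆-trans s' s''))

  mutual
    sound : Red G Γ F → Sound Γ F
    sound r-⊤             Θ s = cp-ax⊤ (here refl)
    sound (r-restart c r) Θ s = cp-⊥R (cp-swapR (cp-contrR (sound r (⊥ᶠ ∷ Θ) s)))
    sound (r-atomic _ c (_ , m , _ , i , ms) bs) =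
      Sound-instance m i c ms tt (sound-branches bs)
    sound (r-backchain _ _ c (_ , m , _ , i , ms) r bs) =
      Sound-instance m i c ms (sound r) (sound-branches bs)
    sound (r-∨R₁ r)       Θ s = cp-∨R₁ (sound r Θ s)
    sound (r-∨R₂ r)       Θ s = cp-∨R₂ (sound r Θ s)
    sound (r-∧R r r')     Θ s = cp-∧R (sound r Θ s) (sound r' Θ s)
    sound (r-⊃R r)        Θ s = cp-⊃R (sound r Θ (∷⁺ʳ _ s))
    sound (r-∃R t r)      Θ s = cp-∃R t (sound r Θ s)

    sound-branches : Branches Γ As → SoundBranches Γ As
    sound-branches []       = []
    sound-branches (b ∷ bs) = sound b ∷ sound-branches bs

theorem4 : (Γ : List (Formula 0)) (G : Formula 0) → All IsClause Γ → IsGoal G →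
           (CProof Γ (G ∷ []) ⇔ Red G Γ G)
theorem4 Γ G cs g = mk⇔
  (λ d → complete G d cs (g ∷ []) ⊆-refl ((λ _ r → r) ∷ []))
  (λ r → cp-contrR (sound G r [] ⊆-refl))
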